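{- Let $n\ge 2$ be a natural number with prime factorization $n=p_1^{r_1}p_2^{r_2}\cdots p_k^{r_k}$, where $p_1,\dots,p_k$ are distinct primes, $k\ge 1$ and $r_i\ge 1$. Let $X_n$ be the unitary Cayley graph of $\mathbb{Z}_n$ and $E$ its edge set. Then $$\chi_s'(X_n)=\frac{|E|}{2^{k-1}}=\frac{n\,\phi(n)}{2^{k}},$$ where $\phi$ is Euler's totient function.
   Context: A strong edge coloring of a simple graph $G$ is a proper edge coloring in which every color class is an induced matching (equivalently, two edges receive different colors whenever they share a vertex or some edge joins an endpoint of one to an endpoint of the other). The strong chromatic index $\chi_s'(G)$ is the minimum number of colors in a strong edge coloring of $G$. Let $U_n=\{m\in\mathbb{Z}_n : \gcd(m,n)=1\}$. The unitary Cayley graph $X_n=\mathrm{Cay}(\mathbb{Z}_n,U_n)$ has vertex set $\mathbb{Z}_n$, with $u$ and $v$ adjacent iff $u-v\in U_n$; it is a $\phi(n)$-regular graph with $n\phi(n)/2$ edges. -}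

module Defs where

open import Data.Nat using (ℕ; zero; suc; _+_; _*_; _∸_; _^_; _≤_; _<_; NonZero)
open import Data.Nat.DivMod using (_%_)
open import Data.Nat.Coprimality using (Coprime; coprime?)
open import Data.Nat.Primality using (Prime; prime?)
open import Data.Nat.Divisibility using (_∣_; _∣?_)
open import Data.Fin using (Fin; toℕ)
open import Data.List using (List; length; filter; upTo)
open import Data.Sum using (_⊎_)
open import Data.Product using (_×_; ∃)
open import Relation.Nullary using (¬_)
open import Relation.Nullary.Decidable using (_×-dec_)
open import Relation.Binary.PropositionalEquality using (_≡_; _≢_)

φ : ℕ → ℕ
φ n = length (filter (λ m → coprime? m n) (upTo n))

ω : ℕ → ℕ
ω n = length (filter (λ p → prime? p ×-dec (p ∣? n)) (upTo (suc n)))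

-- Unitary Cayley graph X_n on vertex set ℤ_n ≅ Fin n:
-- u ~ v  iff  (u - v mod n) ∈ U_n, i.e. gcd((u - v) mod n, n) = 1.
UnitaryAdj : (n : ℕ) → Fin n → Fin n → Set
UnitaryAdj n u v = Coprime (((n + toℕ u) ∸ toℕ v) % suc n') n
  where
  n' : ℕ
  n' = n ∸ 1

SameEdge : {N : ℕ} → Fin N → Fin N → Fin N → Fin N → Set
SameEdge u v x y = (u ≡ x × v ≡ y) ⊎ (u ≡ y × v ≡ x)

Conflict : {N : ℕ} → (Fin N → Fin N → Set) → Fin N → Fin N → Fin N → Fin N → Set
Conflict Adj u v x y =
  (u ≡ x ⊎ u ≡ y ⊎ v ≡ x ⊎ v ≡ y) ⊎ (Adj u x ⊎ Adj u y ⊎ Adj v x ⊎ Adj v y)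

record StrongEdgeColouring {N : ℕ} (Adj : Fin N → Fin N → Set) (m : ℕ) : Set where
  field
    colour    : Fin N → Fin N → Fin m
    symmetric : ∀ u v → Adj u v → colour u v ≡ colour v u
    strong    : ∀ u v x y → Adj u v → Adj x y → ¬ SameEdge u v x y →
                Conflict Adj u v x y → colour u v ≢ colour x y

IsStrongChromaticIndex : {N : ℕ} → (Fin N → Fin N → Set) → ℕ → Set
IsStrongChromaticIndex Adj c =
  StrongEdgeColouring Adj c × (∀ m → StrongEdgeColouring Adj m → c ≤ m)

module Submission where

-- Write n = p₁^r₁ ⋯ p_k^r_k. Vertices of X_n are adjacent iff they differ modulo every pᵢ.
--
-- Orient the edges of X_n both ways, giving nφ(n) arcs (uₜ, vₜ), and let
-- M t s = ∏ₚ (uₛ mod p − vₜ mod p). M t t ≠ 0, while M t s = 0 whenever t ≠ s are arcs of the same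
-- colour, because then vₜ and uₛ are equal or non-adjacent. Expanding the product, M factors through
-- the 2^k products of the terms, so the arcs of one colour number at most 2^k (a rank bound), and a
-- strong edge colouring with m colours has nφ(n) ≤ m 2^k.
--
-- By the Chinese remainder theorem an arc (u, v) is the family of its p-components
-- (u, v) mod pʳ, and exchanging u and v in any set of these components gives again an arc. Each
-- of the 2^k-element orbits contains exactly one canonical arc, whose p-components are all increasing.
-- Colouring an edge by the canonical arc of its orbit is strong: two edges of the same colour have the
-- same unordered p-components for every p, and sharing a vertex or being joined by an edge forces
-- them to coincide. The colours number nφ(n)/2^k.

open import Defs
open import Data.Nat using (ℕ)

module IntegerMatrices where

  open import Data.Nat as ℕ using (ℕ; zero; suc; z≤n; s≤s; _^_)
  open import Data.Nat.Properties using (m≤n⇒m≤1+n)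
  open import Data.Integer using (ℤ; 0ℤ; 1ℤ; _+_; _*_; _-_; -_; _≟_)
  open import Data.Integer.Properties
    using (+-*-semiring; i*j≡0⇒i≡0∨j≡0; +-identityˡ; +-identityʳ; +-assoc; *-identityˡ; *-zeroˡ; *-zeroʳ)
  open import Data.Integer.Tactic.RingSolver using (solve-∀)
  open import Algebra.Properties.Semiring.Sum +-*-semiring
    using (sum; sum-syntax; *-distribˡ-sum; *-distribʳ-sum; ∑-distrib-+; sum-cong-≗; sum-replicate-zero)
  open import Data.Fin using (Fin; zero; suc; punchIn; combine; remQuot; _↑ˡ_; _↑ʳ_)
  open import Data.Fin.Properties using (punchInᵢ≢i; punchIn-injective; any?; remQuot-combine)
    renaming (_≟_ to _≟ᶠ_)
  open import Data.List using (List; []; _∷_; length)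
  open import Data.List.Relation.Unary.Any using (Any; here; there)
  open import Data.List.Relation.Unary.All using (All; []; _∷_)
  open import Data.Product using (_,_; _×_)
  open import Data.Sum using ([_,_]′)
  open import Function using (_∘_)
  open import Relation.Nullary using (yes; no; ¬?)
  open import Relation.Nullary.Decidable using (decidable-stable)
  open import Relation.Nullary.Negation using (contradiction)
  open import Relation.Binary.PropositionalEquality

  ∑-↑ : ∀ m {n} (f : Fin (m ℕ.+ n) → ℤ) → sum f ≡ ∑[ i < m ] f (i ↑ˡ n) + ∑[ j < n ] f (m ↑ʳ j)
  ∑-↑ zero    f = sym (+-identityˡ (sum f))
  ∑-↑ (suc m) f = trans (cong (f zero +_) (∑-↑ m (f ∘ suc))) (sym (+-assoc (f zero) _ _))

  ∑-combine : ∀ m {n} (f : Fin (m ℕ.* n) → ℤ) → sum f ≡ ∑[ i < m ] ∑[ j < n ] f (combine i j)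
  ∑-combine zero        f = refl
  ∑-combine (suc m) {n} f =
    trans (∑-↑ n f) (cong (sum (λ j → f (j ↑ˡ (m ℕ.* n))) +_) (∑-combine m (f ∘ (n ↑ʳ_))))

  ∑-linear : ∀ {d} x y (f g h : Fin d → ℤ) →
             ∑[ j < d ] ((x * f j - y * g j) * h j) ≡ x * ∑[ j < d ] (f j * h j) - y * ∑[ j < d ] (g j * h j)
  ∑-linear {d} x y f g h = begin
    ∑[ j < d ] ((x * f j - y * g j) * h j)
      ≡⟨ sum-cong-≗ (λ j → distribute x y (f j) (g j) (h j)) ⟩
    ∑[ j < d ] (x * (f j * h j) + - y * (g j * h j))
      ≡⟨ ∑-distrib-+ (λ j → x * (f j * h j)) (λ j → - y * (g j * h j)) ⟩
    ∑[ j < d ] (x * (f j * h j)) + ∑[ j < d ] (- y * (g j * h j))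
      ≡⟨ cong₂ _+_ (*-distribˡ-sum x (λ j → f j * h j)) (*-distribˡ-sum (- y) (λ j → g j * h j)) ⟨
    x * ∑[ j < d ] (f j * h j) + - y * ∑[ j < d ] (g j * h j)
      ≡⟨ minus x y _ _ ⟨
    x * ∑[ j < d ] (f j * h j) - y * ∑[ j < d ] (g j * h j) ∎
    where
    open ≡-Reasoning
    distribute : ∀ x y a b c → (x * a - y * b) * c ≡ x * (a * c) + - y * (b * c)
    distribute = solve-∀
    minus : ∀ x y a b → x * a - y * b ≡ x * a + - y * b
    minus = solve-∀

  δ : ∀ {m} → Fin m → Fin m → ℤ
  δ zero    zero    = 1ℤ
  δ zero    (suc _) = 0ℤ
  δ (suc _) zero    = 0ℤ
  δ (suc i) (suc j) = δ i j

  δ-refl : ∀ {m} (i : Fin m) → δ i i ≡ 1ℤ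
  δ-refl zero    = refl
  δ-refl (suc i) = δ-refl i

  δ-≢ : ∀ {m} {i j : Fin m} → i ≢ j → δ i j ≡ 0ℤ
  δ-≢ {i = zero}  {zero}  i≢j = contradiction refl i≢j
  δ-≢ {i = zero}  {suc j} i≢j = refl
  δ-≢ {i = suc i} {zero}  i≢j = refl
  δ-≢ {i = suc i} {suc j} i≢j = δ-≢ (i≢j ∘ cong suc)

  ∑-δ : ∀ {m} (i : Fin m) (f : Fin m → ℤ) → ∑[ j < m ] (δ i j * f j) ≡ f i
  ∑-δ {suc m} zero f = begin
    1ℤ * f zero + ∑[ j < m ] (0ℤ * f (suc j))
      ≡⟨ cong₂ _+_ (*-identityˡ (f zero)) (sum-cong-≗ (λ j → *-zeroˡ (f (suc j)))) ⟩
    f zero + ∑[ j < m ] 0ℤ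
      ≡⟨ cong (f zero +_) (sum-replicate-zero m) ⟩
    f zero + 0ℤ
      ≡⟨ +-identityʳ (f zero) ⟩
    f zero ∎
    where open ≡-Reasoning
  ∑-δ (suc i) f = trans (cong (_+ ∑[ j < _ ] (δ i j * f (suc j))) (*-zeroˡ (f zero)))
                        (trans (+-identityˡ _) (∑-δ i (f ∘ suc)))

  infixl 7 _·_

  _·_ : ∀ {m d} → (Fin m → Fin d → ℤ) → (Fin d → Fin m → ℤ) → Fin m → Fin m → ℤ
  _·_ {d = d} A B t s = ∑[ j < d ] (A t j * B j s)

  IsNonsingularDiagonal : ∀ {m} → (Fin m → Fin m → ℤ) → Set
  IsNonsingularDiagonal M = (∀ t s → t ≢ s → M t s ≡ 0ℤ) × (∀ t → M t t ≢ 0ℤ)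

  ·-zeroColumn : ∀ {m d} (A : Fin m → Fin (suc d) → ℤ) (B : Fin (suc d) → Fin m → ℤ) →
                 (∀ t → A t zero ≡ 0ℤ) → ∀ t s → (A · B) t s ≡ ((λ t j → A t (suc j)) · B ∘ suc) t s
  ·-zeroColumn A B A₀≡0 t s =
    trans (cong (λ a → a * B zero s + ((λ t j → A t (suc j)) · B ∘ suc) t s) (A₀≡0 t)) (+-identityˡ _)

  -- One step of Gaussian elimination over ℤ, with pivot A r zero: subtracting multiples of row r
  -- clears the first column, and scaling instead of dividing keeps the entries integral.
  module _ {m d : ℕ} (A : Fin (suc m) → Fin (suc d) → ℤ) (B : Fin (suc d) → Fin (suc m) → ℤ)
           (r : Fin (suc m)) where

    eliminateRow : Fin m → Fin d → ℤ
    eliminateRow t j = A r zero * A (punchIn r t) (suc j) - A (punchIn r t) zero * A r (suc j)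

    deleteColumn : Fin d → Fin m → ℤ
    deleteColumn j s = B (suc j) (punchIn r s)

    ·-eliminate : ∀ t s → let t′ = punchIn r t; s′ = punchIn r s in
      (eliminateRow · deleteColumn) t s ≡ A r zero * (A · B) t′ s′ - A t′ zero * (A · B) r s′
    ·-eliminate t s = trans
      (∑-linear (A r zero) (A t′ zero) (λ j → A t′ (suc j)) (λ j → A r (suc j)) (λ j → B (suc j) s′))
      (unfold (A r zero) (A t′ zero) (B zero s′) _ _)
      where
      t′ = punchIn r t
      s′ = punchIn r s
      unfold : ∀ a y b T₁ T₂ → a * T₁ - y * T₂ ≡ a * (y * b + T₁) - y * (a * b + T₂)
      unfold = solve-∀

    eliminate-nonsingular : A r zero ≢ 0ℤ → IsNonsingularDiagonal (A · B) →
                            IsNonsingularDiagonal (eliminateRow · deleteColumn)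
    eliminate-nonsingular a≢0 (off , diag) = off′ , diag′
      where
      a = A r zero
      reduced : ∀ t s → (eliminateRow · deleteColumn) t s ≡ a * (A · B) (punchIn r t) (punchIn r s)
      reduced t s = begin
        (eliminateRow · deleteColumn) t s            ≡⟨ ·-eliminate t s ⟩
        a * (A · B) t′ s′ - A t′ zero * (A · B) r s′ ≡⟨ cong (λ z → a * (A · B) t′ s′ - A t′ zero * z) pivotRow ⟩
        a * (A · B) t′ s′ - A t′ zero * 0ℤ           ≡⟨ minus-0 _ (A t′ zero) ⟩
        a * (A · B) t′ s′                            ∎
        where
        open ≡-Reasoning
        t′ = punchIn r t
        s′ = punchIn r s
        pivotRow : (A · B) r s′ ≡ 0ℤ
        pivotRow = off r s′ (punchInᵢ≢i r s ∘ sym)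
        minus-0 : ∀ x y → x - y * 0ℤ ≡ x
        minus-0 = solve-∀
      off′ : ∀ t s → t ≢ s → (eliminateRow · deleteColumn) t s ≡ 0ℤ
      off′ t s t≢s = trans (reduced t s) (trans (cong (a *_) (off _ _ (t≢s ∘ punchIn-injective r t s))) (*-zeroʳ a))
      diag′ : ∀ t → (eliminateRow · deleteColumn) t t ≢ 0ℤ
      diag′ t eq = [ a≢0 , diag (punchIn r t) ]′ (i*j≡0⇒i≡0∨j≡0 a (trans (sym (reduced t t)) eq))

  nonsingularDiagonal⇒≤ : ∀ {m d} (A : Fin m → Fin d → ℤ) (B : Fin d → Fin m → ℤ) →
                          IsNonsingularDiagonal (A · B) → m ℕ.≤ d
  nonsingularDiagonal⇒≤ {zero}          A B _          = z≤n
  nonsingularDiagonal⇒≤ {suc m} {zero}  A B (_ , diag) = contradiction refl (diag zero)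
  nonsingularDiagonal⇒≤ {suc m} {suc d} A B nonsingular@(off , diag) with any? (λ t → ¬? (A t zero ≟ 0ℤ))
  ... | yes (r , a≢0) = s≤s (nonsingularDiagonal⇒≤ (eliminateRow A B r) (deleteColumn A B r)
                                                    (eliminate-nonsingular A B r a≢0 nonsingular))
  ... | no  noPivot   = m≤n⇒m≤1+n (nonsingularDiagonal⇒≤ (λ t j → A t (suc j)) (B ∘ suc)
                          ((λ t s t≢s → trans (sym (dropColumn t s)) (off t s t≢s)) ,
                           (λ t → diag t ∘ trans (dropColumn t t))))
    where
    dropColumn : ∀ t s → (A · B) t s ≡ ((λ t j → A t (suc j)) · B ∘ suc) t s
    dropColumn = ·-zeroColumn A B (λ t → decidable-stable (A t zero ≟ 0ℤ) (noPivot ∘ (t ,_)))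

  -- Giving every colour its own block of d columns makes the product block diagonal.
  module _ {R m d : ℕ} (colour : Fin R → Fin m) (A : Fin R → Fin d → ℤ) (B : Fin d → Fin R → ℤ) where

    private
      blockRows : Fin R → Fin (m ℕ.* d) → ℤ
      blockRows t x = let i , j = remQuot d x in δ (colour t) i * A t j

      blockColumns : Fin (m ℕ.* d) → Fin R → ℤ
      blockColumns x s = let i , j = remQuot d x in δ (colour s) i * B j s

      ·-blocks : ∀ t s → (blockRows · blockColumns) t s ≡ δ (colour s) (colour t) * (A · B) t s
      ·-blocks t s = begin
        (blockRows · blockColumns) t s
          ≡⟨ ∑-combine m (λ x → blockRows t x * blockColumns x s) ⟩
        ∑[ i < m ] ∑[ j < d ] (blockRows t (combine i j) * blockColumns (combine i j) s)
          ≡⟨ sum-cong-≗ (λ i → sum-cong-≗ (λ j →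
               cong₂ (λ (i , j) (i′ , j′) → δ (colour t) i * A t j * (δ (colour s) i′ * B j′ s))
                     (remQuot-combine i j) (remQuot-combine i j))) ⟩
        ∑[ i < m ] ∑[ j < d ] (δ (colour t) i * A t j * (δ (colour s) i * B j s))
          ≡⟨ sum-cong-≗ (λ i → sum-cong-≗ (λ j → regroup (δ (colour t) i) (δ (colour s) i) (A t j) (B j s))) ⟩
        ∑[ i < m ] ∑[ j < d ] (δ (colour t) i * (δ (colour s) i * (A t j * B j s)))
          ≡⟨ sum-cong-≗ (λ i → trans (sym (*-distribˡ-sum {d} (δ (colour t) i) _))
               (cong (δ (colour t) i *_) (sym (*-distribˡ-sum {d} (δ (colour s) i) (λ j → A t j * B j s))))) ⟩
        ∑[ i < m ] (δ (colour t) i * (δ (colour s) i * (A · B) t s))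
          ≡⟨ ∑-δ (colour t) (λ i → δ (colour s) i * (A · B) t s) ⟩
        δ (colour s) (colour t) * (A · B) t s ∎
        where
        open ≡-Reasoning
        regroup : ∀ a b x y → a * x * (b * y) ≡ a * (b * (x * y))
        regroup = solve-∀

    colouredDiagonal⇒≤ : (∀ t s → t ≢ s → colour t ≡ colour s → (A · B) t s ≡ 0ℤ) →
                         (∀ t → (A · B) t t ≢ 0ℤ) → R ℕ.≤ m ℕ.* d
    colouredDiagonal⇒≤ off diag = nonsingularDiagonal⇒≤ blockRows blockColumns (off′ , diag′)
      where
      off′ : ∀ t s → t ≢ s → (blockRows · blockColumns) t s ≡ 0ℤ
      off′ t s t≢s with colour s ≟ᶠ colour t
      ... | yes cs≡ct = trans (·-blocks t s) (trans (cong (δ (colour s) (colour t) *_) (off t s t≢s (sym cs≡ct)))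
                                                     (*-zeroʳ (δ (colour s) (colour t))))
      ... | no  cs≢ct = trans (·-blocks t s) (trans (cong (_* (A · B) t s) (δ-≢ cs≢ct)) (*-zeroˡ ((A · B) t s)))
      diag′ : ∀ t → (blockRows · blockColumns) t t ≢ 0ℤ
      diag′ t eq = diag t (begin
        (A · B) t t                           ≡⟨ *-identityˡ _ ⟨
        1ℤ * (A · B) t t                      ≡⟨ cong (_* (A · B) t t) (δ-refl (colour t)) ⟨
        δ (colour t) (colour t) * (A · B) t t ≡⟨ ·-blocks t t ⟨
        (blockRows · blockColumns) t t        ≡⟨ eq ⟩
        0ℤ                                    ∎)
        where open ≡-Reasoning

  ∏ : {I : Set} → List I → (I → ℤ) → ℤ
  ∏ []       f = 1ℤ
  ∏ (i ∷ is) f = f i * ∏ is f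

  ∏-cong : {I : Set} {f g : I → ℤ} (is : List I) → (∀ i → f i ≡ g i) → ∏ is f ≡ ∏ is g
  ∏-cong []       f≗g = refl
  ∏-cong (i ∷ is) f≗g = cong₂ _*_ (f≗g i) (∏-cong is f≗g)

  ∏-zero : {I : Set} {f : I → ℤ} {is : List I} → Any (λ i → f i ≡ 0ℤ) is → ∏ is f ≡ 0ℤ
  ∏-zero {f = f} {i ∷ is} (here fi≡0)    = trans (cong (_* ∏ is f) fi≡0) (*-zeroˡ (∏ is f))
  ∏-zero {f = f} {i ∷ is} (there any≡0) = trans (cong (f i *_) (∏-zero any≡0)) (*-zeroʳ (f i))

  ∏-nonZero : {I : Set} {f : I → ℤ} {is : List I} → All (λ i → f i ≢ 0ℤ) is → ∏ is f ≢ 0ℤ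
  ∏-nonZero []                             ()
  ∏-nonZero {f = f} {i ∷ is} (fi≢0 ∷ all≢0) eq = [ fi≢0 , ∏-nonZero all≢0 ]′ (i*j≡0⇒i≡0∨j≡0 (f i) eq)

  -- S : Fin (c ^ length is) encodes a choice of one of c terms for each factor, read off by remQuot.
  ∏-choose : {I : Set} {c : ℕ} → (I → Fin c → ℤ) → (is : List I) → Fin (c ^ length is) → ℤ
  ∏-choose         f []       _ = 1ℤ
  ∏-choose {c = c} f (i ∷ is) S = let ε , S′ = remQuot {c} (c ^ length is) S in f i ε * ∏-choose f is S′

  ∏-∑-distrib : {I : Set} {c : ℕ} (f g : I → Fin c → ℤ) (is : List I) →
    ∏ is (λ i → ∑[ ε < c ] (f i ε * g i ε)) ≡ ∑[ S < c ^ length is ] (∏-choose f is S * ∏-choose g is S)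
  ∏-∑-distrib f g []       = refl
  ∏-∑-distrib {c = c} f g (i ∷ is) = sym (begin
    ∑[ S < c ^ length (i ∷ is) ] (∏-choose f (i ∷ is) S * ∏-choose g (i ∷ is) S)
      ≡⟨ ∑-combine c (λ S → ∏-choose f (i ∷ is) S * ∏-choose g (i ∷ is) S) ⟩
    ∑[ ε < c ] ∑[ S < h ] (∏-choose f (i ∷ is) (combine ε S) * ∏-choose g (i ∷ is) (combine ε S))
      ≡⟨ sum-cong-≗ (λ ε → sum-cong-≗ (expandFirst ε)) ⟩
    ∑[ ε < c ] ∑[ S < h ] (f i ε * g i ε * (∏-choose f is S * ∏-choose g is S))
      ≡⟨ sum-cong-≗ (λ ε → sym (*-distribˡ-sum (f i ε * g i ε) (λ S → ∏-choose f is S * ∏-choose g is S))) ⟩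
    ∑[ ε < c ] (f i ε * g i ε * ∑[ S < h ] (∏-choose f is S * ∏-choose g is S))
      ≡⟨ *-distribʳ-sum (∑[ S < h ] (∏-choose f is S * ∏-choose g is S)) (λ ε → f i ε * g i ε) ⟨
    ∑[ ε < c ] (f i ε * g i ε) * ∑[ S < h ] (∏-choose f is S * ∏-choose g is S)
      ≡⟨ cong (∑[ ε < c ] (f i ε * g i ε) *_) (∏-∑-distrib f g is) ⟨
    ∑[ ε < c ] (f i ε * g i ε) * ∏ is (λ j → ∑[ ε < c ] (f j ε * g j ε)) ∎)
    where
    open ≡-Reasoning
    h = c ^ length is
    regroup : ∀ a b x y → a * x * (b * y) ≡ a * b * (x * y)
    regroup = solve-∀
    expandFirst : ∀ ε S → ∏-choose f (i ∷ is) (combine ε S) * ∏-choose g (i ∷ is) (combine ε S) ≡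
                          f i ε * g i ε * (∏-choose f is S * ∏-choose g is S)
    expandFirst ε S = trans
      (cong₂ (λ (ε , S) (ε′ , S′) → f i ε * ∏-choose f is S * (g i ε′ * ∏-choose g is S′))
             (remQuot-combine ε S) (remQuot-combine ε S))
      (regroup (f i ε) (g i ε) (∏-choose f is S) (∏-choose g is S))

module ModularArithmetic where

  open import Data.Nat using (ℕ; zero; suc; _+_; _*_; _∸_; _<_; _≤_; NonZero; ≢-nonZero; nonTrivial⇒≢1)
  open import Data.Nat.Properties
  open import Algebra.Properties.CommutativeSemigroup +-commutativeSemigroup using (x∙yz≈y∙xz)
  open import Data.Nat.DivMod
  open import Data.Nat.Divisibility
  open import Data.Nat.GCD using (gcd[m,n]∣m; gcd[m,n]∣n; gcd[m,n]≡0⇒n≡0)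
  open import Data.Nat.Coprimality using (Coprime; gcd≡1⇒coprime)
  open import Data.Nat.Primality using (Prime; prime⇒nonTrivial)
  open import Data.Nat.Primality.Factorisation using (factorise; PrimeFactorisation)
  open import Data.Nat.ListAction using (product)
  open import Data.List using ([]; _∷_)
  open import Data.List.Relation.Unary.All using (_∷_)
  open import Data.Product using (∃; _×_; _,_)
  open import Data.Sum using ([_,_]′)
  open import Relation.Nullary using (¬_)
  open import Relation.Nullary.Negation using (contradiction)
  open import Function using (_∘_)
  open import Relation.Binary.PropositionalEquality

  -- x mod p, made total (junk value x at p = 0) so that it needs no NonZero instance;
  -- it is only ever used at primes.
  residue : ℕ → ℕ → ℕ
  residue zero    x = x
  residue (suc p) x = x % suc p

  residue≡% : ∀ p .{{_ : NonZero p}} x → residue p x ≡ x % p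
  residue≡% (suc p) x = refl

  ∣∸⇒%≡% : ∀ {a b} d .{{_ : NonZero d}} → b ≤ a → d ∣ a ∸ b → a % d ≡ b % d
  ∣∸⇒%≡% {a} {b} d b≤a d∣a∸b = begin
    a % d           ≡⟨ cong (_% d) (m∸n+n≡m b≤a) ⟨
    (a ∸ b + b) % d ≡⟨ %-remove-+ˡ b d∣a∸b ⟩
    b % d           ∎
    where open ≡-Reasoning

  %≡%⇒∣∸ : ∀ {a b} d .{{_ : NonZero d}} → b ≤ a → a % d ≡ b % d → d ∣ a ∸ b
  %≡%⇒∣∸ {a} {b} d b≤a eq = divides (a / d ∸ b / d) (begin
    a ∸ b                                   ≡⟨ cong₂ _∸_ (m≡m%n+[m/n]*n a d) (m≡m%n+[m/n]*n b d) ⟩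
    a % d + a / d * d ∸ (b % d + b / d * d) ≡⟨ cong (λ r → a % d + a / d * d ∸ (r + b / d * d)) eq ⟨
    a % d + a / d * d ∸ (a % d + b / d * d) ≡⟨ [m+n]∸[m+o]≡n∸o (a % d) (a / d * d) (b / d * d) ⟩
    a / d * d ∸ b / d * d                   ≡⟨ *-distribʳ-∸ d (a / d) (b / d) ⟨
    (a / d ∸ b / d) * d                     ∎)
    where open ≡-Reasoning

  [m+o]∸[n+o]≡m∸n : ∀ m o n → m + o ∸ (n + o) ≡ m ∸ n
  [m+o]∸[n+o]≡m∸n m o n = trans (cong₂ _∸_ (+-comm m o) (+-comm n o)) ([m+n]∸[m+o]≡n∸o o m n)

  %-cancelʳ-+ : ∀ a b c d .{{_ : NonZero d}} → (a + c) % d ≡ (b + c) % d → a % d ≡ b % d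
  %-cancelʳ-+ a b c d eq = [ (λ b≤a → cancel b≤a eq) , (λ a≤b → sym (cancel a≤b (sym eq))) ]′ (≤-total b a)
    where
    cancel : ∀ {a b} → b ≤ a → (a + c) % d ≡ (b + c) % d → a % d ≡ b % d
    cancel {a} {b} b≤a eq =
      ∣∸⇒%≡% d b≤a (subst (d ∣_) ([m+o]∸[n+o]≡m∸n a c b) (%≡%⇒∣∸ d (+-monoˡ-≤ c b≤a) eq))

  [m+n%d]%d≡[m+n]%d : ∀ m n d .{{_ : NonZero d}} → (m + n % d) % d ≡ (m + n) % d
  [m+n%d]%d≡[m+n]%d m n d = trans (%-distribˡ-+ m (n % d) d)
    (trans (cong (λ r → (m % d + r) % d) (m%n%n≡m%n n d)) (sym (%-distribˡ-+ m n d)))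

  difference : (n : ℕ) .{{_ : NonZero n}} → ℕ → ℕ → ℕ
  difference n u v = (n + u ∸ v) % n

  module _ {n : ℕ} .{{_ : NonZero n}} {u v : ℕ} (v≤n : v ≤ n) where

    private
      v≤n+u : v ≤ n + u
      v≤n+u = ≤-trans v≤n (m≤m+n n u)

    ∣difference⇒%≡% : ∀ {d} .{{_ : NonZero d}} → d ∣ n → d ∣ difference n u v → u % d ≡ v % d
    ∣difference⇒%≡% {d} d∣n d∣diff =
      trans (sym (%-remove-+ˡ u d∣n)) (∣∸⇒%≡% d v≤n+u (∣n∣m%n⇒∣m d∣n d∣diff))

    %≡%⇒∣difference : ∀ {d} .{{_ : NonZero d}} → d ∣ n → u % d ≡ v % d → d ∣ difference n u v
    %≡%⇒∣difference {d} d∣n eq =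
      %-presˡ-∣ (%≡%⇒∣∸ d v≤n+u (trans (%-remove-+ˡ u d∣n) eq)) d∣n

    difference-+ : u < n → (v + difference n u v) % n ≡ u
    difference-+ u<n = begin
      (v + difference n u v) % n ≡⟨ [m+n%d]%d≡[m+n]%d v (n + u ∸ v) n ⟩
      (v + (n + u ∸ v)) % n      ≡⟨ cong (_% n) (m+[n∸m]≡n v≤n+u) ⟩
      (n + u) % n                ≡⟨ %-remove-+ˡ u ∣-refl ⟩
      u % n                      ≡⟨ m<n⇒m%n≡m u<n ⟩
      u                          ∎
      where open ≡-Reasoning

  difference-self : ∀ n .{{_ : NonZero n}} u → difference n u u ≡ 0
  difference-self n u = trans (cong (_% n) (m+n∸n≡m n u)) (n%n≡0 n)

  difference-injectiveʳ : ∀ {n} .{{_ : NonZero n}} {u v v′} → u < n → v < n → v′ < n →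
                          difference n u v ≡ difference n u v′ → v ≡ v′
  difference-injectiveʳ {n} {u} {v} {v′} u<n v<n v′<n eq = begin
    v      ≡⟨ m<n⇒m%n≡m v<n ⟨
    v % n  ≡⟨ %-cancelʳ-+ v v′ (difference n u v) n (trans (difference-+ (<⇒≤ v<n) u<n)
                    (sym (trans (cong (λ d → (v′ + d) % n) eq) (difference-+ (<⇒≤ v′<n) u<n)))) ⟩
    v′ % n ≡⟨ m<n⇒m%n≡m v′<n ⟩
    v′     ∎
    where open ≡-Reasoning

  difference-∸ : ∀ {n} .{{_ : NonZero n}} {u w} → u < n → w < n → difference n u ((u + (n ∸ w)) % n) ≡ w
  difference-∸ {n} {u} {w} u<n w<n = begin
    difference n u v     ≡⟨ m%n%n≡m%n (n + u ∸ v) n ⟨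
    difference n u v % n ≡⟨ %-cancelʳ-+ (difference n u v) w v n (begin
                              (difference n u v + v) % n ≡⟨ cong (_% n) (+-comm (difference n u v) v) ⟩
                              (v + difference n u v) % n ≡⟨ difference-+ (<⇒≤ (m%n<n _ n)) u<n ⟩
                              u                          ≡⟨ w+v≡u ⟨
                              (w + v) % n                ∎) ⟩
    w % n                ≡⟨ m<n⇒m%n≡m w<n ⟩
    w                    ∎
    where
    open ≡-Reasoning
    v = (u + (n ∸ w)) % n
    w+v≡u : (w + v) % n ≡ u
    w+v≡u = begin
      (w + v) % n             ≡⟨ [m+n%d]%d≡[m+n]%d w (u + (n ∸ w)) n ⟩
      (w + (u + (n ∸ w))) % n ≡⟨ cong (_% n) (x∙yz≈y∙xz w u (n ∸ w)) ⟩
      (u + (w + (n ∸ w))) % n ≡⟨ cong (λ m → (u + m) % n) (m+[n∸m]≡n (<⇒≤ w<n)) ⟩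
      (u + n) % n             ≡⟨ [m+n]%n≡m%n u n ⟩
      u % n                   ≡⟨ m<n⇒m%n≡m u<n ⟩
      u                       ∎

  ∃prime∣ : ∀ {a} → a ≢ 0 → a ≢ 1 → ∃ λ p → Prime p × p ∣ a
  ∃prime∣ {a} a≢0 a≢1 with factorise a {{≢-nonZero a≢0}}
  ... | record { factors = [] ; isFactorisation = a≡1 } = contradiction a≡1 a≢1
  ... | record { factors = p ∷ ps ; isFactorisation = a≡p*ps ; factorsPrime = prime[p] ∷ _ } =
    p , prime[p] , subst (p ∣_) (sym a≡p*ps) (m∣m*n (product ps))

  ¬coprime⇒∃prime∣ : ∀ {a n} → n ≢ 0 → ¬ Coprime a n → ∃ λ p → Prime p × p ∣ a × p ∣ n
  ¬coprime⇒∃prime∣ {a} {n} n≢0 ¬coprime =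
    let p , prime[p] , p∣gcd = ∃prime∣ (n≢0 ∘ gcd[m,n]≡0⇒n≡0 a) (¬coprime ∘ gcd≡1⇒coprime)
    in p , prime[p] , ∣-trans p∣gcd (gcd[m,n]∣m a n) , ∣-trans p∣gcd (gcd[m,n]∣n a n)

  prime∣⇒¬coprime : ∀ {p a b} → Prime p → p ∣ a → p ∣ b → ¬ Coprime a b
  prime∣⇒¬coprime prime[p] p∣a p∣b coprime = nonTrivial⇒≢1 {{prime⇒nonTrivial prime[p]}} (coprime (p∣a , p∣b))

module PrimeBlocks where

  open import Data.Nat using (ℕ; suc; _*_; _≤_; s≤s; _≟_; ≢-nonZero⁻¹)
  open import Data.Nat.Properties using (*-assoc; *-comm; ≤-trans; ≤-refl; *-commutativeSemigroup)
  open import Algebra.Properties.CommutativeSemigroup *-commutativeSemigroup using (x∙yz≈y∙xz)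
  open import Data.Nat.Divisibility
  open import Data.Nat.Coprimality using (Coprime; coprime-divisor)
  open import Data.Nat.Primality using (Prime; productOfPrimes≢0)
  open import Data.Nat.Primality.Factorisation using (factorisationHasAllPrimeFactors)
  open import Data.Nat.ListAction using (product)
  open import Data.List using (List; []; _∷_; filter; length)
  open import Data.List.Properties using (filter-accept; filter-reject; length-filter)
  open import Data.List.Relation.Unary.All using (All)
  open import Data.List.Relation.Unary.All.Properties using () renaming (filter⁺ to all-filter⁺)
  open import Data.List.Membership.Propositional using (_∈_)
  open import Data.List.Membership.Propositional.Properties using (∈-filter⁻)
  open import Data.List.Relation.Unary.Any using (here)
  open import Data.Product using (_,_; proj₂)
  open import Function using (_∘_)
  open import Relation.Nullary using (yes; no; ¬?; Dec)
  open import Relation.Nullary.Decidable using (decidable-stable)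
  open import Relation.Nullary.Negation using (contradiction)
  open import Relation.Unary using (Decidable)
  open import Relation.Binary.PropositionalEquality
  open ModularArithmetic using (∃prime∣)

  product-filter : ∀ {P : ℕ → Set} (P? : Decidable P) xs →
                   product xs ≡ product (filter P? xs) * product (filter (¬? ∘ P?) xs)
  product-filter P? [] = refl
  product-filter P? (x ∷ xs) with P? x
  ... | yes _ = trans (cong (x *_) (product-filter P? xs)) (sym (*-assoc x _ _))
  ... | no  _ = trans (cong (x *_) (product-filter P? xs)) (x∙yz≈y∙xz x (product (filter P? xs)) _)

  product-filter-∣ : ∀ {P Q : ℕ → Set} (P? : Decidable P) (Q? : Decidable Q) → (∀ {x} → P x → Q x) →
                     ∀ xs → product (filter P? xs) ∣ product (filter Q? xs)
  product-filter-∣ P? Q? P⇒Q [] = ∣-refl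
  product-filter-∣ P? Q? P⇒Q (x ∷ xs) with P? x | Q? x
  ... | yes _  | yes _  = *-monoʳ-∣ x (product-filter-∣ P? Q? P⇒Q xs)
  ... | yes px | no ¬qx = contradiction (P⇒Q px) ¬qx
  ... | no _   | yes _  = ∣-trans (product-filter-∣ P? Q? P⇒Q xs) (n∣m*n x)
  ... | no _   | no _   = product-filter-∣ P? Q? P⇒Q xs

  coprime-∣⇒*∣ : ∀ {a b c} → Coprime a b → a ∣ c → b ∣ c → a * b ∣ c
  coprime-∣⇒*∣ {a} {b} coprime a∣c (divides t refl) =
    *-monoˡ-∣ b (coprime-divisor coprime (subst (a ∣_) (*-comm t b) a∣c))

  block coblock : List ℕ → ℕ → ℕ
  block   L p = product (filter (p ≟_) L)
  coblock L p = product (filter (¬? ∘ (p ≟_)) L)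

  product≡block*coblock : ∀ L p → product L ≡ block L p * coblock L p
  product≡block*coblock L p = product-filter (p ≟_) L

  block∣coblock : ∀ L {p p′} → p′ ≢ p → block L p′ ∣ coblock L p
  block∣coblock L {p} {p′} p′≢p =
    product-filter-∣ (p′ ≟_) (¬? ∘ (p ≟_)) (λ p′≡x p≡x → p′≢p (trans p′≡x (sym p≡x))) L

  coprime-block-coblock : ∀ {L} → All Prime L → ∀ p → Coprime (block L p) (coblock L p)
  coprime-block-coblock {L} primes p {i} (i∣block , i∣coblock) = decidable-stable (i ≟ 1) λ i≢1 →
    let r , prime[r] , r∣i = ∃prime∣ i≢0 i≢1
        r∈block   = factorisationHasAllPrimeFactors prime[r] (∣-trans r∣i i∣block)
                                                    (all-filter⁺ (p ≟_) primes)
        r∈coblock = factorisationHasAllPrimeFactors prime[r] (∣-trans r∣i i∣coblock)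
                                                    (all-filter⁺ (¬? ∘ (p ≟_)) primes)
    in ∈-filter⁻ (¬? ∘ (p ≟_)) {xs = L} r∈coblock .proj₂ (∈-filter⁻ (p ≟_) {xs = L} r∈block .proj₂)
    where
    i≢0 : i ≢ 0
    i≢0 refl = ≢-nonZero⁻¹ _ {{productOfPrimes≢0 (all-filter⁺ (p ≟_) primes)}} (0∣⇒≡0 i∣block)

  filter-coblock : ∀ {p p′} → p′ ≢ p → ∀ L → filter (p′ ≟_) (filter (¬? ∘ (p ≟_)) L) ≡ filter (p′ ≟_) L
  filter-coblock p′≢p [] = refl
  filter-coblock {p} {p′} p′≢p (x ∷ L) with p ≟ x
  ... | yes p≡x = begin
    filter (p′ ≟_) (filter (¬? ∘ (p ≟_)) (x ∷ L))
      ≡⟨ cong (filter (p′ ≟_)) (filter-reject (¬? ∘ (p ≟_)) (λ p≢x → p≢x p≡x)) ⟩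
    filter (p′ ≟_) (filter (¬? ∘ (p ≟_)) L)
      ≡⟨ filter-coblock p′≢p L ⟩
    filter (p′ ≟_) L
      ≡⟨ filter-reject (p′ ≟_) (λ p′≡x → p′≢p (trans p′≡x (sym p≡x))) ⟨
    filter (p′ ≟_) (x ∷ L) ∎
    where open ≡-Reasoning
  ... | no p≢x = begin
    filter (p′ ≟_) (filter (¬? ∘ (p ≟_)) (x ∷ L)) ≡⟨ cong (filter (p′ ≟_)) (filter-accept (¬? ∘ (p ≟_)) p≢x) ⟩
    filter (p′ ≟_) (x ∷ filter (¬? ∘ (p ≟_)) L)   ≡⟨ head-case (p′ ≟ x) ⟩
    filter (p′ ≟_) (x ∷ L)                        ∎
    where
    open ≡-Reasoning
    head-case : Dec (p′ ≡ x) → filter (p′ ≟_) (x ∷ filter (¬? ∘ (p ≟_)) L) ≡ filter (p′ ≟_) (x ∷ L)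
    head-case (yes p′≡x) = trans (filter-accept (p′ ≟_) p′≡x)
      (trans (cong (x ∷_) (filter-coblock p′≢p L)) (sym (filter-accept (p′ ≟_) p′≡x)))
    head-case (no p′≢x) = trans (filter-reject (p′ ≟_) p′≢x)
      (trans (filter-coblock p′≢p L) (sym (filter-reject (p′ ≟_) p′≢x)))

  -- The head block is coprime to the rest, which is shorter and has the same blocks.
  blocks∣⇒product∣ : ∀ {L} → All Prime L → ∀ {D} → (∀ {p} → p ∈ L → block L p ∣ D) → product L ∣ D
  blocks∣⇒product∣ {L} = go (length L) ≤-refl
    where
    go : ∀ fuel {xs} → length xs ≤ fuel → All Prime xs → ∀ {D} →
         (∀ {p} → p ∈ xs → block xs p ∣ D) → product xs ∣ D
    go _          {[]}     _              _      _       = 1∣ _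
    go (suc fuel) {p ∷ L′} (s≤s |L′|≤fuel) primes {D} blocks∣ =
      subst (_∣ D) (sym (product≡block*coblock xs p))
        (coprime-∣⇒*∣ (coprime-block-coblock primes p) (blocks∣ (here refl)) coblock∣)
      where
      xs = p ∷ L′
      rest = filter (¬? ∘ (p ≟_)) xs
      |rest|≤fuel : length rest ≤ fuel
      |rest|≤fuel = subst (λ ys → length ys ≤ fuel) (sym (filter-reject (¬? ∘ (p ≟_)) (λ p≢p → p≢p refl)))
                          (≤-trans (length-filter (¬? ∘ (p ≟_)) L′) |L′|≤fuel)
      coblock∣ : coblock xs p ∣ D
      coblock∣ = go fuel |rest|≤fuel (all-filter⁺ (¬? ∘ (p ≟_)) primes) λ {p′} p′∈rest →
        let p′∈xs , p′≢p = ∈-filter⁻ (¬? ∘ (p ≟_)) {xs = xs} p′∈rest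
        in subst (_∣ D) (cong product (sym (filter-coblock (p′≢p ∘ sym) xs))) (blocks∣ p′∈xs)

module UnorderedPairs where

  open import Data.Nat using (ℕ; _<_; _≤_; _⊓_; _⊔_)
  open import Data.Nat.Properties
  open import Data.Fin using (Fin; zero; suc)
  open import Data.Product using (_×_; _,_; proj₁; proj₂; swap)
  open import Data.Sum using (_⊎_; inj₁; inj₂)
  open import Function using (id; _∘_)
  open import Relation.Nullary using (yes; no)
  open import Relation.Nullary.Negation using (contradiction)
  open import Relation.Binary.PropositionalEquality

  infix 4 _≃_

  _≃_ : ℕ × ℕ → ℕ × ℕ → Set
  x ≃ y = x ≡ y ⊎ x ≡ swap y

  sort : ℕ × ℕ → ℕ × ℕ
  sort (a , b) = a ⊓ b , a ⊔ b

  sort-swap : ∀ x → sort (swap x) ≡ sort x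
  sort-swap (a , b) = cong₂ _,_ (⊓-comm b a) (⊔-comm b a)

  sort-≤ : ∀ {a b} → a ≤ b → sort (a , b) ≡ (a , b)
  sort-≤ a≤b = cong₂ _,_ (m≤n⇒m⊓n≡m a≤b) (m≤n⇒m⊔n≡n a≤b)

  sort-≥ : ∀ {a b} → b ≤ a → sort (a , b) ≡ (b , a)
  sort-≥ b≤a = trans (sym (sort-swap _)) (sort-≤ b≤a)

  sort≡⇒≃ : ∀ x y → sort x ≡ sort y → x ≃ y
  sort≡⇒≃ (a , b) (c , d) eq with ≤-total a b | ≤-total c d
  ... | inj₁ a≤b | inj₁ c≤d = inj₁ (trans (sym (sort-≤ a≤b)) (trans eq (sort-≤ c≤d)))
  ... | inj₁ a≤b | inj₂ d≤c = inj₂ (trans (sym (sort-≤ a≤b)) (trans eq (sort-≥ d≤c)))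
  ... | inj₂ b≤a | inj₁ c≤d = inj₂ (cong swap (trans (sym (sort-≥ b≤a)) (trans eq (sort-≤ c≤d))))
  ... | inj₂ b≤a | inj₂ d≤c = inj₁ (cong swap (trans (sym (sort-≥ b≤a)) (trans eq (sort-≥ d≤c))))

  sort-< : ∀ {a b} → a ≢ b → proj₁ (sort (a , b)) < proj₂ (sort (a , b))
  sort-< {a} {b} a≢b with ≤-total a b
  ... | inj₁ a≤b = subst (λ (x , y) → x < y) (sym (sort-≤ a≤b)) (≤∧≢⇒< a≤b a≢b)
  ... | inj₂ b≤a = subst (λ (x , y) → x < y) (sym (sort-≥ b≤a)) (≤∧≢⇒< b≤a (a≢b ∘ sym))

  swapIf : Fin 2 → ℕ × ℕ → ℕ × ℕ
  swapIf zero    = id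
  swapIf (suc _) = swap

  order : ℕ × ℕ → Fin 2
  order (a , b) with b <? a
  ... | yes _ = suc zero
  ... | no  _ = zero

  swapIf-order : ∀ x → swapIf (order x) x ≡ sort x
  swapIf-order (a , b) with b <? a
  ... | yes b<a = sym (sort-≥ (<⇒≤ b<a))
  ... | no  b≮a = sym (sort-≤ (≮⇒≥ b≮a))

  swapIf-injective : ∀ {x} → proj₁ x ≢ proj₂ x → ∀ ε ε′ → swapIf ε x ≡ swapIf ε′ x → ε ≡ ε′
  swapIf-injective x₁≢x₂ zero          zero          _  = refl
  swapIf-injective x₁≢x₂ zero          (suc zero)    eq = contradiction (cong proj₁ eq) x₁≢x₂
  swapIf-injective x₁≢x₂ (suc zero)    zero          eq = contradiction (cong proj₂ eq) x₁≢x₂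
  swapIf-injective x₁≢x₂ (suc zero)    (suc zero)    _  = refl

  sort-swapIf : ∀ ε x → sort (swapIf ε x) ≡ sort x
  sort-swapIf zero    x = refl
  sort-swapIf (suc _) x = sort-swap x

module Enumerations where

  open import Data.Nat using (zero; suc; _^_)
  open import Data.List using (List; _∷_; lookup)
  open import Data.List.Relation.Unary.All using () renaming (lookup to all-lookup)
  open import Data.List.Relation.Unary.AllPairs using (_∷_)
  open import Data.List.Relation.Unary.Unique.Propositional using (Unique)
  open import Data.List.Membership.Propositional.Properties using (∈-lookup)
  open import Data.Fin using (Fin; zero; suc; combine; finToFun; funToFin)
  open import Data.Fin.Properties using (funToFin-finToFin)
  open import Function using (_∘_)
  open import Relation.Nullary.Negation using (contradiction)
  open import Relation.Binary.PropositionalEquality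

  Unique⇒lookup-injective : ∀ {A : Set} {xs : List A} → Unique xs → ∀ i j → lookup xs i ≡ lookup xs j → i ≡ j
  Unique⇒lookup-injective (_ ∷ _)      zero    zero    _  = refl
  Unique⇒lookup-injective (x∉xs ∷ _)   zero    (suc j) eq = contradiction eq (all-lookup x∉xs (∈-lookup j))
  Unique⇒lookup-injective (x∉xs ∷ _)   (suc i) zero    eq = contradiction (sym eq) (all-lookup x∉xs (∈-lookup i))
  Unique⇒lookup-injective (_ ∷ unique) (suc i) (suc j) eq = cong suc (Unique⇒lookup-injective unique i j eq)

  funToFin-cong : ∀ {m n} {f g : Fin m → Fin n} → (∀ i → f i ≡ g i) → funToFin f ≡ funToFin g
  funToFin-cong {zero}  f≗g = refl
  funToFin-cong {suc m} f≗g = cong₂ combine (f≗g zero) (funToFin-cong (f≗g ∘ suc))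

  finToFun-injective : ∀ {m n} {i j : Fin (m ^ n)} → (∀ x → finToFun {m} {n} i x ≡ finToFun j x) → i ≡ j
  finToFun-injective {m} {n} {i} {j} eq =
    trans (sym (funToFin-finToFin {n} {m} i)) (trans (funToFin-cong eq) (funToFin-finToFin {n} {m} j))

module UnitaryCayley (n-2 : ℕ) where

  open import Data.Nat using (ℕ; suc; _+_; _*_; _∸_; _<_; s≤s)
  open import Data.Nat.Properties using (<⇒≤)
  open import Data.Nat.DivMod using (m%n<n)
  open import Data.Nat.Divisibility using (_∣_; _∣?_; ∣⇒≤; _∣0; ∣-refl)
  open import Data.Nat.Coprimality using (Coprime; coprime?)
  open import Data.Nat.Primality using (Prime; prime?; prime⇒nonZero)
  open import Data.List using (List; filter; upTo; lookup)
  open import Data.List.Relation.Unary.All using (All; tabulate)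
  open import Data.List.Relation.Unary.All.Properties using (All¬⇒¬Any)
  open import Data.List.Relation.Unary.Any using (Any)
  import Data.List.Relation.Unary.Any as Any
  open import Data.List.Relation.Unary.Any.Properties using (lookup-index)
  open import Data.List.Relation.Unary.Unique.Propositional using (Unique)
  import Data.List.Relation.Unary.Unique.Propositional.Properties as Unique
  open import Data.List.Membership.Propositional using (_∈_; lose)
  open import Data.List.Membership.Propositional.Properties using (∈-filter⁺; ∈-filter⁻; ∈-upTo⁺; ∈-upTo⁻; ∈-lookup)
  open import Data.Fin using (Fin; toℕ; fromℕ<; remQuot; combine)
  open import Data.Fin.Properties using (toℕ<n; toℕ-injective; toℕ-fromℕ<; combine-remQuot; remQuot-combine)
  open import Data.Product using (∃; _×_; _,_; proj₁; proj₂)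
  open import Function using (_∘_)
  open import Relation.Nullary using (¬_)
  open import Relation.Nullary.Decidable using (_×-dec_; decidable-stable)
  open import Relation.Binary.PropositionalEquality
  open ModularArithmetic
  open Enumerations

  n : ℕ
  n = suc (suc n-2)

  -- For n ≥ 1 the modulus suc (n ∸ 1) in UnitaryAdj reduces to n, so Adjacent u v is definitionally
  -- Coprime (difference n (toℕ u) (toℕ v)) n.
  Adjacent : Fin n → Fin n → Set
  Adjacent = UnitaryAdj n

  primeDivisors : List ℕ
  primeDivisors = filter (λ p → prime? p ×-dec (p ∣? n)) (upTo (suc n))

  ∈primeDivisors⁻ : ∀ {p} → p ∈ primeDivisors → Prime p × p ∣ n
  ∈primeDivisors⁻ = proj₂ ∘ ∈-filter⁻ (λ p → prime? p ×-dec (p ∣? n)) {xs = upTo (suc n)}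

  ∈primeDivisors⁺ : ∀ {p} → Prime p → p ∣ n → p ∈ primeDivisors
  ∈primeDivisors⁺ prime[p] p∣n =
    ∈-filter⁺ (λ p → prime? p ×-dec (p ∣? n)) (∈-upTo⁺ (s≤s (∣⇒≤ p∣n))) (prime[p] , p∣n)

  primeDivisors-unique : Unique primeDivisors
  primeDivisors-unique = Unique.filter⁺ (λ p → prime? p ×-dec (p ∣? n)) (Unique.upTo⁺ (suc n))

  ResiduesDiffer : Fin n → Fin n → Set
  ResiduesDiffer u v = All (λ p → residue p (toℕ u) ≢ residue p (toℕ v)) primeDivisors

  ResidueAgrees : Fin n → Fin n → Set
  ResidueAgrees u v = Any (λ p → residue p (toℕ u) ≡ residue p (toℕ v)) primeDivisors

  adjacent⇒residuesDiffer : ∀ {u v} → Adjacent u v → ResiduesDiffer u v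
  adjacent⇒residuesDiffer {u} {v} coprime = tabulate λ {p} p∈ps same →
    let prime[p] , p∣n = ∈primeDivisors⁻ p∈ps
        instance _ = prime⇒nonZero prime[p]
        u≡v = trans (sym (residue≡% p (toℕ u))) (trans same (residue≡% p (toℕ v)))
    in prime∣⇒¬coprime prime[p] (%≡%⇒∣difference (<⇒≤ (toℕ<n v)) p∣n u≡v) p∣n coprime

  ¬adjacent⇒residueAgrees : ∀ {u v} → ¬ Adjacent u v → ResidueAgrees u v
  ¬adjacent⇒residueAgrees {u} {v} ¬coprime =
    let p , prime[p] , p∣difference , p∣n = ¬coprime⇒∃prime∣ (λ ()) ¬coprime
        instance _ = prime⇒nonZero prime[p]
        u≡v = ∣difference⇒%≡% (<⇒≤ (toℕ<n v)) p∣n p∣difference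
    in lose (∈primeDivisors⁺ prime[p] p∣n) (trans (residue≡% p (toℕ u)) (trans u≡v (sym (residue≡% p (toℕ v)))))

  residuesDiffer⇒adjacent : ∀ {u v} → ResiduesDiffer u v → Adjacent u v
  residuesDiffer⇒adjacent differ =
    decidable-stable (coprime? _ n) (All¬⇒¬Any differ ∘ ¬adjacent⇒residueAgrees)

  adjacent-irrefl : ∀ u → ¬ Adjacent u u
  adjacent-irrefl u coprime with () ← coprime (subst (n ∣_) (sym (difference-self n (toℕ u))) (n ∣0) , ∣-refl)

  units : List ℕ
  units = filter (λ m → coprime? m n) (upTo n)

  units-unique : Unique units
  units-unique = Unique.filter⁺ (λ m → coprime? m n) (Unique.upTo⁺ n)

  ∈units⁻ : ∀ {w} → w ∈ units → w < n × Coprime w n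
  ∈units⁻ w∈units = let w∈upTo , coprime = ∈-filter⁻ (λ m → coprime? m n) {xs = upTo n} w∈units
                    in ∈-upTo⁻ w∈upTo , coprime

  Arc : Set
  Arc = Fin n × Fin n

  IsEdge : Arc → Set
  IsEdge (u , v) = Adjacent u v

  _⊖_ : Fin n → ℕ → Fin n
  u ⊖ w = fromℕ< (m%n<n (toℕ u + (n ∸ w)) n)

  difference-⊖ : ∀ u {w} → w < n → difference n (toℕ u) (toℕ (u ⊖ w)) ≡ w
  difference-⊖ u {w} w<n =
    trans (cong (difference n (toℕ u)) (toℕ-fromℕ< (m%n<n (toℕ u + (n ∸ w)) n))) (difference-∸ (toℕ<n u) w<n)

  arc : Fin (n * φ n) → Arc
  arc r = let u , j = remQuot (φ n) r in u , u ⊖ lookup units j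

  arc-isEdge : ∀ r → IsEdge (arc r)
  arc-isEdge r = let u , j = remQuot {n} (φ n) r; w<n , coprime = ∈units⁻ (∈-lookup j)
                 in subst (λ d → Coprime d n) (sym (difference-⊖ u w<n)) coprime

  arc-injective : ∀ {r r′} → arc r ≡ arc r′ → r ≡ r′
  arc-injective {r} {r′} eq = begin
    r                           ≡⟨ combine-remQuot {n} (φ n) r ⟨
    combine (proj₁ (arc r)) j   ≡⟨ cong₂ combine (cong proj₁ eq)
                                            (Unique⇒lookup-injective units-unique j j′ sameUnit) ⟩
    combine (proj₁ (arc r′)) j′ ≡⟨ combine-remQuot {n} (φ n) r′ ⟩
    r′                          ∎
    where
    open ≡-Reasoning
    j  = proj₂ (remQuot {n} (φ n) r)
    j′ = proj₂ (remQuot {n} (φ n) r′)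
    arcDifference : Arc → ℕ
    arcDifference (u , v) = difference n (toℕ u) (toℕ v)
    sameUnit : lookup units j ≡ lookup units j′
    sameUnit = begin
      lookup units j        ≡⟨ difference-⊖ (proj₁ (arc r)) (proj₁ (∈units⁻ (∈-lookup j))) ⟨
      arcDifference (arc r)  ≡⟨ cong arcDifference eq ⟩
      arcDifference (arc r′) ≡⟨ difference-⊖ (proj₁ (arc r′)) (proj₁ (∈units⁻ (∈-lookup j′))) ⟩
      lookup units j′       ∎

  arc-surjective : ∀ e → IsEdge e → ∃ λ r → arc r ≡ e
  arc-surjective (u , v) coprime = combine u j , cong₂ _,_ (cong proj₁ split) (begin
    proj₂ (arc (combine u j)) ≡⟨ cong (λ (u , j) → u ⊖ lookup units j) split ⟩
    u ⊖ lookup units j        ≡⟨ cong (u ⊖_) (lookup-index w∈units) ⟨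
    u ⊖ w                     ≡⟨ toℕ-injective
                                   (difference-injectiveʳ (toℕ<n u) (toℕ<n _) (toℕ<n v) (difference-⊖ u w<n)) ⟩
    v                         ∎)
    where
    open ≡-Reasoning
    w = difference n (toℕ u) (toℕ v)
    w<n = m%n<n (n + toℕ u ∸ toℕ v) n
    w∈units = ∈-filter⁺ (λ m → coprime? m n) (∈-upTo⁺ w<n) coprime
    j = Any.index w∈units
    split : remQuot {n} (φ n) (combine u j) ≡ (u , j)
    split = remQuot-combine u j
module LowerBound (n-2 : ℕ) where

  open import Data.Nat as ℕ using (ℕ; zero; suc; _^_; _≤_)
  open import Data.Integer using (ℤ; 0ℤ; 1ℤ; +_; _*_; _+_; _-_; -_)
  open import Data.Integer.Properties using (+-*-semiring; +-injective; i-j≡0⇒i≡j; i≡j⇒i-j≡0)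
  open import Data.Integer.Tactic.RingSolver using (solve-∀)
  open import Algebra.Properties.Semiring.Sum +-*-semiring using (sum; sum-syntax)
  open import Data.List using (length)
  open import Data.List.Relation.Unary.All using () renaming (map to all-map)
  open import Data.List.Relation.Unary.Any using () renaming (map to any-map)
  open import Data.Fin using (Fin; zero; suc; toℕ)
  open import Data.Product using (_,_; proj₁; proj₂)
  open import Data.Sum using (inj₁; inj₂)
  open import Function using (_∘_)
  open import Relation.Nullary using (¬_)
  open import Relation.Binary.PropositionalEquality
  open ModularArithmetic using (residue)
  open IntegerMatrices
  open UnitaryCayley n-2

  coordinate : Fin n → ℕ → ℤ
  coordinate x p = + residue p (toℕ x)

  -- Each factor aₚ − bₚ of ∏ₚ (aₚ − bₚ) is the dot product (1, −bₚ) · (aₚ, 1), which separates the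
  -- target b of one arc from the source a of the other.
  targetTerm sourceTerm : Fin n → ℕ → Fin 2 → ℤ
  targetTerm v p zero    = 1ℤ
  targetTerm v p (suc _) = - coordinate v p
  sourceTerm u p zero    = coordinate u p
  sourceTerm u p (suc _) = 1ℤ

  ∑-terms : ∀ u v p → ∑[ ε < 2 ] (targetTerm v p ε * sourceTerm u p ε) ≡ coordinate u p - coordinate v p
  ∑-terms u v p = dot (coordinate u p) (coordinate v p)
    where
    dot : ∀ a b → 1ℤ * a + (- b * 1ℤ + 0ℤ) ≡ a - b
    dot = solve-∀

  source target : Fin (n ℕ.* φ n) → Fin n
  source = proj₁ ∘ arc
  target = proj₂ ∘ arc

  module _ {m : ℕ} (colouring : StrongEdgeColouring Adjacent m) where

    open StrongEdgeColouring colouring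

    arcColour : Fin (n ℕ.* φ n) → Fin m
    arcColour t = colour (source t) (target t)

    sameColour⇒¬adjacent : ∀ {t s} → t ≢ s → arcColour t ≡ arcColour s → ¬ Adjacent (target t) (source s)
    sameColour⇒¬adjacent {t} {s} t≢s same adjacent =
      strong (source t) (target t) (source s) (target s) (arc-isEdge t) (arc-isEdge s)
             differentEdges (inj₂ (inj₂ (inj₂ (inj₁ adjacent)))) same
      where
      differentEdges : ¬ SameEdge (source t) (target t) (source s) (target s)
      differentEdges (inj₁ (sameSource , sameTarget)) = t≢s (arc-injective (cong₂ _,_ sameSource sameTarget))
      differentEdges (inj₂ (_ , target≡source))         =
        adjacent-irrefl (target t) (subst (Adjacent (target t)) (sym target≡source) adjacent)

    rows : Fin (n ℕ.* φ n) → Fin (2 ^ length primeDivisors) → ℤ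
    rows t = ∏-choose (targetTerm (target t)) primeDivisors

    columns : Fin (2 ^ length primeDivisors) → Fin (n ℕ.* φ n) → ℤ
    columns S s = ∏-choose (sourceTerm (source s)) primeDivisors S

    rows·columns : ∀ t s → (rows · columns) t s ≡
                           ∏ primeDivisors (λ p → coordinate (source s) p - coordinate (target t) p)
    rows·columns t s = trans (sym (∏-∑-distrib (targetTerm (target t)) (sourceTerm (source s)) primeDivisors))
                             (∏-cong primeDivisors (∑-terms (source s) (target t)))

    colouring⇒n*φn≤m*2^ω : n ℕ.* φ n ≤ m ℕ.* 2 ^ length primeDivisors
    colouring⇒n*φn≤m*2^ω = colouredDiagonal⇒≤ arcColour rows columns off diag
      where
      off : ∀ t s → t ≢ s → arcColour t ≡ arcColour s → (rows · columns) t s ≡ 0ℤ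
      off t s t≢s same = trans (rows·columns t s) (∏-zero (any-map (λ eq → i≡j⇒i-j≡0 (cong +_ (sym eq)))
        (¬adjacent⇒residueAgrees (sameColour⇒¬adjacent t≢s same))))
      diag : ∀ t → (rows · columns) t t ≢ 0ℤ
      diag t = ∏-nonZero (all-map (λ differ eq → differ (+-injective (i-j≡0⇒i≡j _ _ eq)))
                                  (adjacent⇒residuesDiffer (arc-isEdge t)))
             ∘ trans (sym (rows·columns t t))
module ChineseRemainder (n-2 : ℕ) where

  open import Data.Nat using (ℕ; _+_; _*_; _∸_; _≤_; NonZero; _≟_; ≢-nonZero)
  open import Data.Nat.Properties
  open import Data.Nat.DivMod
  open import Data.Nat.Divisibility
  open import Data.Nat.GCD using (module Bézout)
  open import Data.Nat.Coprimality using (coprime-Bézout)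
  open import Data.Nat.Primality using (prime⇒nonZero)
  open import Data.Nat.Primality.Factorisation using (factorise; PrimeFactorisation; factorisationHasAllPrimeFactors)
  open import Data.Nat.ListAction.Properties using (∈⇒∣product)
  open import Data.List.Relation.Unary.All as All using (All)
  open import Data.List.Membership.Propositional using (_∈_)
  open import Data.List.Membership.Propositional.Properties using (∈-filter⁺)
  open import Data.Fin using (Fin; toℕ; fromℕ<)
  open import Data.Fin.Properties using (toℕ<n; toℕ-injective; toℕ-fromℕ<)
  open import Data.Product using (_,_; proj₁)
  open import Data.Sum using ([_,_]′)
  open import Function using (_∘_)
  open import Relation.Nullary using (yes; no)
  open import Relation.Nullary.Negation using (contradiction)
  open import Relation.Binary.PropositionalEquality
  open ModularArithmetic
  open PrimeBlocks
  open UnitaryCayley n-2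

  private
    factorisation : PrimeFactorisation n
    factorisation = factorise n

  open PrimeFactorisation factorisation using (factors; factorsPrime; isFactorisation)

  part copart : ℕ → ℕ
  part   = block factors
  copart = coblock factors

  n≡part*copart : ∀ p → n ≡ part p * copart p
  n≡part*copart p = trans isFactorisation (product≡block*coblock factors p)

  part∣n : ∀ p → part p ∣ n
  part∣n p = divides (copart p) (trans (n≡part*copart p) (*-comm (part p) (copart p)))

  copart∣n : ∀ p → copart p ∣ n
  copart∣n p = divides (part p) (n≡part*copart p)

  part∣copart : ∀ {p p′} → p′ ≢ p → part p′ ∣ copart p
  part∣copart = block∣coblock factors

  instance
    part-nonZero : ∀ {p} → NonZero (part p)
    part-nonZero {p} = ≢-nonZero λ part≡0 →
      contradiction (trans (n≡part*copart p) (cong (_* copart p) part≡0)) λ ()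

  ∈primeDivisors⇒∈factors : ∀ {p} → p ∈ primeDivisors → p ∈ factors
  ∈primeDivisors⇒∈factors p∈ps = let prime[p] , p∣n = ∈primeDivisors⁻ p∈ps
    in factorisationHasAllPrimeFactors prime[p] (subst (_ ∣_) isFactorisation p∣n) factorsPrime

  ∈factors⇒∈primeDivisors : ∀ {p} → p ∈ factors → p ∈ primeDivisors
  ∈factors⇒∈primeDivisors p∈fs =
    ∈primeDivisors⁺ (All.lookup factorsPrime p∈fs) (subst (_ ∣_) (sym isFactorisation) (∈⇒∣product p∈fs))

  p∣part : ∀ {p} → p ∈ primeDivisors → p ∣ part p
  p∣part {p} p∈ps = ∈⇒∣product (∈-filter⁺ (p ≟_) (∈primeDivisors⇒∈factors p∈ps) refl)

  ≡-mod-part⇒residue≡ : ∀ {p} → p ∈ primeDivisors → ∀ a b → a % part p ≡ b % part p → residue p a ≡ residue p b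
  ≡-mod-part⇒residue≡ {p} p∈ps a b eq = begin
    residue p a    ≡⟨ residue≡% p a ⟩
    a % p          ≡⟨ m∣n⇒o%n%m≡o%m p (part p) a (p∣part p∈ps) ⟨
    a % part p % p ≡⟨ cong (_% p) eq ⟩
    b % part p % p ≡⟨ m∣n⇒o%n%m≡o%m p (part p) b (p∣part p∈ps) ⟩
    b % p          ≡⟨ residue≡% p b ⟨
    residue p b    ∎
    where
    open ≡-Reasoning
    instance
      p-nonZero : NonZero p
      p-nonZero = prime⇒nonZero (proj₁ (∈primeDivisors⁻ p∈ps))

  ≡-mod-parts⇒≡ : ∀ {x y : Fin n} → (∀ {p} → p ∈ primeDivisors → toℕ x % part p ≡ toℕ y % part p) → x ≡ y
  ≡-mod-parts⇒≡ {x} {y} parts≡ = toℕ-injective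
    ([ (λ y≤x → sym (≤-mod-parts⇒≡ y≤x (sym ∘ parts≡))) , (λ x≤y → ≤-mod-parts⇒≡ x≤y parts≡) ]′
     (≤-total (toℕ y) (toℕ x)))
    where
    ≤-mod-parts⇒≡ : ∀ {a b : Fin n} → toℕ a ≤ toℕ b →
                    (∀ {p} → p ∈ primeDivisors → toℕ a % part p ≡ toℕ b % part p) → toℕ a ≡ toℕ b
    ≤-mod-parts⇒≡ {a} {b} a≤b parts≡ with toℕ b ∸ toℕ a ≟ 0
    ... | yes b∸a≡0 = ≤-antisym a≤b (m∸n≡0⇒m≤n b∸a≡0)
    ... | no  b∸a≢0 =
      contradiction n∣b∸a (>⇒∤ {{≢-nonZero b∸a≢0}} (≤-<-trans (m∸n≤m (toℕ b) (toℕ a)) (toℕ<n b)))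
      where
      n∣b∸a : n ∣ toℕ b ∸ toℕ a
      n∣b∸a = subst (_∣ toℕ b ∸ toℕ a) (sym isFactorisation) (blocks∣⇒product∣ factorsPrime λ p∈fs →
                %≡%⇒∣∸ _ a≤b (sym (parts≡ (∈factors⇒∈primeDivisors p∈fs))))

  -- blend x y E ≡ x + E (y − x) (mod n): congruent to y modulo divisors d of n with E ≡ 1 (mod d),
  -- and to x where E ≡ 0 (mod d).
  blend : Fin n → Fin n → ℕ → Fin n
  blend x y E = fromℕ< (m%n<n (toℕ x + E * (toℕ y + n ∸ toℕ x)) n)

  module _ {d : ℕ} .{{_ : NonZero d}} (d∣n : d ∣ n) (x y : Fin n) (E : ℕ) where

    private
      w = toℕ y + n ∸ toℕ x

      blend%d : toℕ (blend x y E) % d ≡ (toℕ x + E * w) % d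
      blend%d = trans (cong (_% d) (toℕ-fromℕ< _)) (m∣n⇒o%n%m≡o%m d n _ d∣n)

    blend-≡ʳ : E % d ≡ 1 % d → toℕ (blend x y E) % d ≡ toℕ y % d
    blend-≡ʳ E≡1 = begin
      toℕ (blend x y E) % d               ≡⟨ blend%d ⟩
      (toℕ x + E * w) % d                 ≡⟨ %-distribˡ-+ (toℕ x) (E * w) d ⟩
      (toℕ x % d + E * w % d) % d         ≡⟨ cong (λ z → (toℕ x % d + z) % d) Ew≡w ⟩
      (toℕ x % d + w % d) % d             ≡⟨ %-distribˡ-+ (toℕ x) w d ⟨
      (toℕ x + w) % d                     ≡⟨ cong (_% d) (m+[n∸m]≡n (≤-trans (<⇒≤ (toℕ<n x)) (m≤n+m n (toℕ y)))) ⟩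
      (toℕ y + n) % d                     ≡⟨ %-remove-+ʳ (toℕ y) d∣n ⟩
      toℕ y % d                           ∎
      where
      open ≡-Reasoning
      Ew≡w : E * w % d ≡ w % d
      Ew≡w = trans (%-distribˡ-* E w d) (trans (cong (λ e → e * (w % d) % d) E≡1)
                   (trans (sym (%-distribˡ-* 1 w d)) (cong (_% d) (*-identityˡ w))))

    blend-≡ˡ : d ∣ E → toℕ (blend x y E) % d ≡ toℕ x % d
    blend-≡ˡ d∣E = trans blend%d (%-remove-+ʳ (toℕ x) (∣m⇒∣m*n w d∣E))

  record Exchange (p : ℕ) : Set where
    field
      exchange        : Fin n → Fin n → Fin n
      exchange-part   : ∀ x y → toℕ (exchange x y) % part p ≡ toℕ y % part p
      exchange-copart : ∀ {d} .{{_ : NonZero d}} → d ∣ copart p → ∀ x y → toℕ (exchange x y) % d ≡ toℕ x % d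

  -- A Bézout identity for part p and copart p yields E ≡ 1 (mod part p) with copart p ∣ E, or the
  -- complementary E, in which case x and y trade places. Opaque: only the specification is ever used,
  -- and unfolding the Bézout computation makes unification needlessly expensive.
  opaque
    exchangeAt : ∀ p → Exchange p
    exchangeAt p with coprime-Bézout (coprime-block-coblock factorsPrime p)
    ... | Bézout.-+ a b 1+a*part≡b*copart = record
      { exchange        = λ x y → blend x y (b * copart p)
      ; exchange-part   = λ x y → blend-≡ʳ (part∣n p) x y _
                                (trans (cong (_% part p) (sym 1+a*part≡b*copart)) ([m+kn]%n≡m%n 1 a (part p)))
      ; exchange-copart = λ d∣copart x y →
                            blend-≡ˡ (∣-trans d∣copart (copart∣n p)) x y _ (∣-trans d∣copart (n∣m*n b))
      }
    ... | Bézout.+- a b 1+b*copart≡a*part = record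
      { exchange        = λ x y → blend y x (a * part p)
      ; exchange-part   = λ x y → blend-≡ˡ (part∣n p) y x _ (n∣m*n a)
      ; exchange-copart = λ d∣copart x y → blend-≡ʳ (∣-trans d∣copart (copart∣n p)) y x _
          (trans (cong (_% _) (sym 1+b*copart≡a*part)) (%-remove-+ʳ 1 (∣-trans d∣copart (n∣m*n b))))
      }

module UpperBound (n-2 : ℕ) where

  open import Data.Nat using (ℕ; zero; suc; _*_; _^_; _<_; _≤_; _≟_; s≤s; z≤n)
  open import Data.Nat.Properties
  open import Data.Nat.DivMod
  open import Data.Nat.Divisibility
  open import Data.Nat.Coprimality using (Coprime; coprime?; 1-coprimeTo)
  open import Data.List using (List; []; _∷_; filter; length; lookup; allFin)
  open import Data.List.Relation.Unary.AllPairs using (_∷_)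
  open import Data.List.Relation.Unary.All as All using (All)
  open import Data.List.Membership.Propositional using (_∈_)
  open import Data.List.Relation.Unary.Any using (here; there)
  open import Data.List.Membership.Propositional.Properties using (∈-filter⁺; ∈-filter⁻; ∈-lookup; ∈-allFin)
  open import Data.List.Relation.Unary.Any.Properties using (lookup-index)
  import Data.List.Relation.Unary.Any as Any
  import Data.List.Relation.Unary.Unique.Propositional.Properties as Unique
  open import Data.Fin using (Fin; zero; suc; toℕ; combine; remQuot; finToFun)
  open import Data.Fin.Properties using (combine-remQuot; injective⇒≤)
  open import Data.Product using (∃; _×_; _,_; proj₁; proj₂; swap)
  open import Data.Sum using (inj₁; inj₂; [_,_]′)
  open import Function using (_∘_; id)
  open import Data.List.Relation.Unary.Unique.Propositional using (Unique)
  open import Relation.Nullary using (¬_; yes; no; Dec)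
  open import Data.Empty using (⊥-elim)
  open import Relation.Binary.PropositionalEquality
  open ModularArithmetic using (residue; difference)
  open Enumerations
  open UnitaryCayley n-2
  open ChineseRemainder n-2
  open UnorderedPairs

  component : ℕ → Arc → ℕ × ℕ
  component p (x , y) = toℕ x % part p , toℕ y % part p

  components⇒≡ : ∀ {e e′} → (∀ {p} → p ∈ primeDivisors → component p e ≡ component p e′) → e ≡ e′
  components⇒≡ same = cong₂ _,_ (≡-mod-parts⇒≡ (cong proj₁ ∘ same)) (≡-mod-parts⇒≡ (cong proj₂ ∘ same))

  exchangeArc : ℕ → Arc → Arc
  exchangeArc p (x , y) = exchange x y , exchange y x
    where open Exchange (exchangeAt p)

  component-exchangeArc : ∀ p e → component p (exchangeArc p e) ≡ swap (component p e)
  component-exchangeArc p (x , y) = cong₂ _,_ (exchange-part x y) (exchange-part y x)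
    where open Exchange (exchangeAt p)

  component-exchangeArc-≢ : ∀ {p p′} → p′ ≢ p → ∀ e → component p′ (exchangeArc p e) ≡ component p′ e
  component-exchangeArc-≢ {p} {p′} p′≢p (x , y) =
    cong₂ _,_ (exchange-copart (part∣copart p′≢p) x y) (exchange-copart (part∣copart p′≢p) y x)
    where open Exchange (exchangeAt p)

  exchangeArc-involutive : ∀ p e → exchangeArc p (exchangeArc p e) ≡ e
  exchangeArc-involutive p e = components⇒≡ λ {p′} _ → twice p′
    where
    twice : ∀ p′ → component p′ (exchangeArc p (exchangeArc p e)) ≡ component p′ e
    twice p′ with p′ ≟ p
    ... | yes refl = trans (component-exchangeArc p _) (cong swap (component-exchangeArc p e))
    ... | no  p′≢p = trans (component-exchangeArc-≢ p′≢p _) (component-exchangeArc-≢ p′≢p e)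

  exchangeArc-injective : ∀ p {e e′} → exchangeArc p e ≡ exchangeArc p e′ → e ≡ e′
  exchangeArc-injective p {e} {e′} eq =
    trans (sym (exchangeArc-involutive p e)) (trans (cong (exchangeArc p) eq) (exchangeArc-involutive p e′))

  exchangeIf : Fin 2 → ℕ → Arc → Arc
  exchangeIf zero    p = id
  exchangeIf (suc _) p = exchangeArc p

  component-exchangeIf : ∀ ε p e → component p (exchangeIf ε p e) ≡ swapIf ε (component p e)
  component-exchangeIf zero    p e = refl
  component-exchangeIf (suc _) p e = component-exchangeArc p e

  component-exchangeIf-≢ : ∀ ε {p p′} → p′ ≢ p → ∀ e → component p′ (exchangeIf ε p e) ≡ component p′ e
  component-exchangeIf-≢ zero    p′≢p e = refl
  component-exchangeIf-≢ (suc _) p′≢p e = component-exchangeArc-≢ p′≢p e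

  exchangeIf-injective : ∀ ε p {e e′} → exchangeIf ε p e ≡ exchangeIf ε p e′ → e ≡ e′
  exchangeIf-injective zero    p eq = eq
  exchangeIf-injective (suc _) p eq = exchangeArc-injective p eq

  exchangeAll : (L : List ℕ) → (Fin (length L) → Fin 2) → Arc → Arc
  exchangeAll []      S e = e
  exchangeAll (p ∷ L) S e = exchangeIf (S zero) p (exchangeAll L (S ∘ suc) e)

  component-exchangeAll-∉ : ∀ L S e {p} → ¬ p ∈ L → component p (exchangeAll L S e) ≡ component p e
  component-exchangeAll-∉ []       S e p∉L = refl
  component-exchangeAll-∉ (p′ ∷ L) S e p∉L =
    trans (component-exchangeIf-≢ (S zero) (p∉L ∘ here) _) (component-exchangeAll-∉ L (S ∘ suc) e (p∉L ∘ there))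

  sort-component-exchangeAll : ∀ L S e p → sort (component p (exchangeAll L S e)) ≡ sort (component p e)
  sort-component-exchangeAll []       S e p = refl
  sort-component-exchangeAll (p′ ∷ L) S e p with p ≟ p′
  ... | no  p≢p′ = trans (cong sort (component-exchangeIf-≢ (S zero) p≢p′ (exchangeAll L (S ∘ suc) e)))
                         (sort-component-exchangeAll L (S ∘ suc) e p)
  ... | yes refl = begin
    sort (component p (exchangeIf (S zero) p (exchangeAll L (S ∘ suc) e)))
      ≡⟨ cong sort (component-exchangeIf (S zero) p (exchangeAll L (S ∘ suc) e)) ⟩
    sort (swapIf (S zero) (component p (exchangeAll L (S ∘ suc) e)))
      ≡⟨ sort-swapIf (S zero) _ ⟩
    sort (component p (exchangeAll L (S ∘ suc) e))
      ≡⟨ sort-component-exchangeAll L (S ∘ suc) e p ⟩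
    sort (component p e) ∎
    where open ≡-Reasoning

  selection : (L : List ℕ) → Arc → Fin (length L) → Fin 2
  selection L e i = order (component (lookup L i) e)

  component-exchangeAll-selection : ∀ {L} → Unique L → ∀ e {p} → p ∈ L →
                                    component p (exchangeAll L (selection L e) e) ≡ sort (component p e)
  component-exchangeAll-selection {p ∷ L} (p∉L ∷ _) e (here refl) = begin
    component p (exchangeIf (order (component p e)) p (exchangeAll L (selection L e) e))
      ≡⟨ component-exchangeIf (order (component p e)) p _ ⟩
    swapIf (order (component p e)) (component p (exchangeAll L (selection L e) e))
      ≡⟨ cong (swapIf (order (component p e)))
              (component-exchangeAll-∉ L (selection L e) e (λ p∈L → All.lookup p∉L p∈L refl)) ⟩
    swapIf (order (component p e)) (component p e)
      ≡⟨ swapIf-order (component p e) ⟩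
    sort (component p e) ∎
    where open ≡-Reasoning
  component-exchangeAll-selection {p′ ∷ L} (p′∉L ∷ unique) e (there p∈L) =
    trans (component-exchangeIf-≢ (order (component p′ e)) (λ p≡p′ → All.lookup p′∉L p∈L (sym p≡p′))
                                  (exchangeAll L (selection L e) e))
          (component-exchangeAll-selection unique e p∈L)

  canon : Arc → Arc
  canon e = exchangeAll primeDivisors (selection primeDivisors e) e

  component-canon : ∀ e {p} → p ∈ primeDivisors → component p (canon e) ≡ sort (component p e)
  component-canon e = component-exchangeAll-selection primeDivisors-unique e

  canon-swap : ∀ e → canon (swap e) ≡ canon e
  canon-swap (u , v) = components⇒≡ λ {p} p∈ps → begin
    component p (canon (v , u)) ≡⟨ component-canon (v , u) p∈ps ⟩
    sort (component p (v , u))  ≡⟨ sort-swap (component p (u , v)) ⟩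
    sort (component p (u , v))  ≡⟨ component-canon (u , v) p∈ps ⟨
    component p (canon (u , v)) ∎
    where open ≡-Reasoning

  isEdge⇒components-differ : ∀ {e} → IsEdge e → ∀ {p} → p ∈ primeDivisors →
                             proj₁ (component p e) ≢ proj₂ (component p e)
  isEdge⇒components-differ {u , v} adjacent p∈ps eq =
    All.lookup (adjacent⇒residuesDiffer adjacent) p∈ps (≡-mod-part⇒residue≡ p∈ps (toℕ u) (toℕ v) eq)

  ≃-components⇒isEdge : ∀ {e e′} → IsEdge e → (∀ {p} → p ∈ primeDivisors → component p e′ ≃ component p e) →
                        IsEdge e′
  ≃-components⇒isEdge {u , v} {u′ , v′} adjacent ≃e =
    residuesDiffer⇒adjacent (All.tabulate λ {p} p∈ps → differ p∈ps (≃e p∈ps))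
    where
    residue≡ : ∀ {p} → p ∈ primeDivisors → ∀ {a b} → a % part p ≡ b % part p → residue p a ≡ residue p b
    residue≡ p∈ps = ≡-mod-part⇒residue≡ p∈ps _ _
    differ : ∀ {p} → p ∈ primeDivisors → component p (u′ , v′) ≃ component p (u , v) →
             residue p (toℕ u′) ≢ residue p (toℕ v′)
    differ p∈ps (inj₁ eq) same = All.lookup (adjacent⇒residuesDiffer adjacent) p∈ps
      (trans (sym (residue≡ p∈ps (cong proj₁ eq))) (trans same (residue≡ p∈ps (cong proj₂ eq))))
    differ p∈ps (inj₂ eq) same = All.lookup (adjacent⇒residuesDiffer adjacent) p∈ps
      (sym (trans (sym (residue≡ p∈ps (cong proj₁ eq))) (trans same (residue≡ p∈ps (cong proj₂ eq)))))

  exchangeAll-isEdge : ∀ S {e} → IsEdge e → IsEdge (exchangeAll primeDivisors S e)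
  exchangeAll-isEdge S {e} isEdge = ≃-components⇒isEdge isEdge λ {p} _ →
    sort≡⇒≃ _ _ (sort-component-exchangeAll primeDivisors S e p)

  IsCanonical : Arc → Set
  IsCanonical e = All (λ p → proj₁ (component p e) < proj₂ (component p e)) primeDivisors

  isCanonical? : ∀ e → Dec (IsCanonical e)
  isCanonical? e = All.all? (λ p → proj₁ (component p e) <? proj₂ (component p e)) primeDivisors

  canon-isCanonical : ∀ {e} → IsEdge e → IsCanonical (canon e)
  canon-isCanonical {e} isEdge = All.tabulate λ {p} p∈ps →
    subst (λ (a , b) → a < b) (sym (component-canon e p∈ps)) (sort-< (isEdge⇒components-differ isEdge p∈ps))

  canon-exchangeAll : ∀ {c} → IsCanonical c → ∀ S → canon (exchangeAll primeDivisors S c) ≡ c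
  canon-exchangeAll {c} canonical S = components⇒≡ λ {p} p∈ps → begin
    component p (canon (exchangeAll primeDivisors S c)) ≡⟨ component-canon _ p∈ps ⟩
    sort (component p (exchangeAll primeDivisors S c))  ≡⟨ sort-component-exchangeAll primeDivisors S c p ⟩
    sort (component p c)                                ≡⟨ sort-≤ (<⇒≤ (All.lookup canonical p∈ps)) ⟩
    component p c                                       ∎
    where open ≡-Reasoning

  exchangeAll-injective : ∀ {L} → Unique L → ∀ {c} → (∀ {p} → p ∈ L → proj₁ (component p c) ≢ proj₂ (component p c)) →
                          ∀ S S′ → exchangeAll L S c ≡ exchangeAll L S′ c → ∀ i → S i ≡ S′ i
  exchangeAll-injective {[]}    _              _      S S′ eq ()
  exchangeAll-injective {p ∷ L} (p∉L ∷ unique) {c} differ S S′ eq = λ where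
      zero    → head≡
      (suc i) → exchangeAll-injective unique (differ ∘ there) (S ∘ suc) (S′ ∘ suc)
                  (exchangeIf-injective (S zero) p (trans eq (cong (λ ε → exchangeIf ε p _) (sym head≡)))) i
    where
    p∉L′ : ¬ p ∈ L
    p∉L′ p∈L = All.lookup p∉L p∈L refl
    component-p : ∀ T → component p (exchangeAll (p ∷ L) T c) ≡ swapIf (T zero) (component p c)
    component-p T = trans (component-exchangeIf (T zero) p _)
                          (cong (swapIf (T zero)) (component-exchangeAll-∉ L (T ∘ suc) c p∉L′))
    head≡ : S zero ≡ S′ zero
    head≡ = swapIf-injective (differ (here refl)) (S zero) (S′ zero)
              (trans (sym (component-p S)) (trans (cong (component p) eq) (component-p S′)))

  private
    R : ℕ
    R = n * φ n

  canonicalArcs : List (Fin R)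
  canonicalArcs = filter (isCanonical? ∘ arc) (allFin R)

  C : ℕ
  C = length canonicalArcs

  canonicalArc : Fin C → Arc
  canonicalArc a = arc (lookup canonicalArcs a)

  canonicalArc-isCanonical : ∀ a → IsCanonical (canonicalArc a)
  canonicalArc-isCanonical a = proj₂ (∈-filter⁻ (isCanonical? ∘ arc) {xs = allFin R} (∈-lookup a))

  canonicalArc-injective : ∀ {a a′} → canonicalArc a ≡ canonicalArc a′ → a ≡ a′
  canonicalArc-injective eq =
    Unique⇒lookup-injective (Unique.filter⁺ (isCanonical? ∘ arc) (Unique.allFin⁺ R)) _ _ (arc-injective eq)

  canon-index : ∀ e → IsEdge e → ∃ λ a → canonicalArc a ≡ canon e
  canon-index e isEdge =
    let r , arc-r≡canon = arc-surjective (canon e) (exchangeAll-isEdge (selection primeDivisors e) {e} isEdge)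
        r∈canonicalArcs = ∈-filter⁺ (isCanonical? ∘ arc) (∈-allFin r)
                            (subst IsCanonical (sym arc-r≡canon) (canon-isCanonical {e} isEdge))
    in Any.index r∈canonicalArcs , trans (cong arc (sym (lookup-index r∈canonicalArcs))) arc-r≡canon

  isEdge-1,0 : IsEdge (suc zero , zero)
  isEdge-1,0 = subst (λ d → Coprime d n) (sym difference≡1) (1-coprimeTo n)
    where
    difference≡1 : difference n 1 0 ≡ 1
    difference≡1 = trans (%-remove-+ˡ {n} 1 {n} ∣-refl) (m<n⇒m%n≡m {n} {1} (s≤s (s≤s z≤n)))

  -- Non-edges get an arbitrary colour: a strong edge colouring never inspects them.
  colourOf : ∀ u v → Dec (Adjacent u v) → Fin C
  colourOf u v (yes isEdge) = proj₁ (canon-index (u , v) isEdge)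
  colourOf u v (no  _)      = proj₁ (canon-index (suc zero , zero) isEdge-1,0)

  colourOf-canon : ∀ {u v} (adjacent? : Dec (Adjacent u v)) → Adjacent u v →
                   canonicalArc (colourOf u v adjacent?) ≡ canon (u , v)
  colourOf-canon {u} {v} (yes isEdge) _      = proj₂ (canon-index (u , v) isEdge)
  colourOf-canon         (no ¬isEdge) isEdge = ⊥-elim (¬isEdge isEdge)

  colour : Fin n → Fin n → Fin C
  colour u v = colourOf u v (coprime? _ n)

  colour-canon : ∀ u v → Adjacent u v → canonicalArc (colour u v) ≡ canon (u , v)
  colour-canon u v = colourOf-canon (coprime? _ n)

  colour-symmetric : ∀ u v → Adjacent u v → colour u v ≡ colour v u
  colour-symmetric u v isEdge = canonicalArc-injective (begin
    canonicalArc (colour u v) ≡⟨ colour-canon u v isEdge ⟩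
    canon (u , v)             ≡⟨ canon-swap (u , v) ⟨
    canon (v , u)             ≡⟨ colour-canon v u (≃-components⇒isEdge {u , v} {v , u} isEdge (λ _ → inj₂ refl)) ⟨
    canonicalArc (colour v u) ∎)
    where open ≡-Reasoning

  module _ {u v x y : Fin n} (uv : Adjacent u v) (xy : Adjacent x y) (same : colour u v ≡ colour x y) where

    private
      _≡ₚ_ : Fin n → Fin n → ℕ → Set
      (a ≡ₚ b) p = toℕ a % part p ≡ toℕ b % part p

      differ : ∀ {a b} → Adjacent a b → ∀ {p} → p ∈ primeDivisors → ¬ (a ≡ₚ b) p
      differ {a} {b} = isEdge⇒components-differ {a , b}

      ≡⇒≡ₚ : ∀ {a b} → a ≡ b → ∀ p → (a ≡ₚ b) p
      ≡⇒≡ₚ refl p = refl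

      sameCanon : canon (u , v) ≡ canon (x , y)
      sameCanon = trans (sym (colour-canon u v uv)) (trans (cong canonicalArc same) (colour-canon x y xy))

      ≃uv : ∀ {p} → p ∈ primeDivisors → component p (x , y) ≃ component p (u , v)
      ≃uv {p} p∈ps = sort≡⇒≃ _ _ (begin
        sort (component p (x , y))  ≡⟨ component-canon (x , y) p∈ps ⟨
        component p (canon (x , y)) ≡⟨ cong (component p) sameCanon ⟨
        component p (canon (u , v)) ≡⟨ component-canon (u , v) p∈ps ⟩
        sort (component p (u , v))  ∎)
        where open ≡-Reasoning

    sameColour-aligned : (∀ {p} → p ∈ primeDivisors → ¬ ((x ≡ₚ v) p × (y ≡ₚ u) p)) → SameEdge u v x y
    sameColour-aligned misaligned = inj₁ (sym (cong proj₁ xy≡uv) , sym (cong proj₂ xy≡uv))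
      where
      xy≡uv : (x , y) ≡ (u , v)
      xy≡uv = components⇒≡ λ p∈ps →
        [ id , (λ eq → ⊥-elim (misaligned p∈ps (cong proj₁ eq , cong proj₂ eq))) ]′ (≃uv p∈ps)

    sameColour-reversed : (∀ {p} → p ∈ primeDivisors → ¬ ((x ≡ₚ u) p × (y ≡ₚ v) p)) → SameEdge u v x y
    sameColour-reversed aligned = inj₂ (sym (cong proj₂ xy≡vu) , sym (cong proj₁ xy≡vu))
      where
      xy≡vu : (x , y) ≡ (v , u)
      xy≡vu = components⇒≡ λ p∈ps →
        [ (λ eq → ⊥-elim (aligned p∈ps (cong proj₁ eq , cong proj₂ eq))) , id ]′ (≃uv p∈ps)

    sameColour-conflict⇒sameEdge : Conflict Adjacent u v x y → SameEdge u v x y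
    sameColour-conflict⇒sameEdge (inj₁ (inj₁ u≡x)) =
      sameColour-aligned λ {p} p∈ps (x≡v , _) → differ uv p∈ps (trans (≡⇒≡ₚ u≡x p) x≡v)
    sameColour-conflict⇒sameEdge (inj₁ (inj₂ (inj₁ u≡y))) =
      sameColour-reversed λ {p} p∈ps (_ , y≡v) → differ uv p∈ps (trans (≡⇒≡ₚ u≡y p) y≡v)
    sameColour-conflict⇒sameEdge (inj₁ (inj₂ (inj₂ (inj₁ v≡x)))) =
      sameColour-reversed λ {p} p∈ps (x≡u , _) → differ uv p∈ps (sym (trans (≡⇒≡ₚ v≡x p) x≡u))
    sameColour-conflict⇒sameEdge (inj₁ (inj₂ (inj₂ (inj₂ v≡y)))) =
      sameColour-aligned λ {p} p∈ps (_ , y≡u) → differ uv p∈ps (sym (trans (≡⇒≡ₚ v≡y p) y≡u))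
    sameColour-conflict⇒sameEdge (inj₂ (inj₁ ux)) =
      sameColour-reversed λ p∈ps (x≡u , _) → differ ux p∈ps (sym x≡u)
    sameColour-conflict⇒sameEdge (inj₂ (inj₂ (inj₁ uy))) =
      sameColour-aligned λ p∈ps (_ , y≡u) → differ uy p∈ps (sym y≡u)
    sameColour-conflict⇒sameEdge (inj₂ (inj₂ (inj₂ (inj₁ vx)))) =
      sameColour-aligned λ p∈ps (x≡v , _) → differ vx p∈ps (sym x≡v)
    sameColour-conflict⇒sameEdge (inj₂ (inj₂ (inj₂ (inj₂ vy)))) =
      sameColour-reversed λ p∈ps (_ , y≡v) → differ vy p∈ps (sym y≡v)

  strongEdgeColouring : StrongEdgeColouring Adjacent C
  strongEdgeColouring = record
    { colour    = colour
    ; symmetric = colour-symmetric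
    ; strong    = λ u v x y uv xy ¬sameEdge conflict same →
                    ¬sameEdge (sameColour-conflict⇒sameEdge uv xy same conflict)
    }

  private
    primeCount : ℕ
    primeCount = length primeDivisors

  exchangedArc : Fin C → (Fin primeCount → Fin 2) → Arc
  exchangedArc a S = exchangeAll primeDivisors S (canonicalArc a)

  exchangedArc-injective : ∀ {a a′ S S′} → exchangedArc a S ≡ exchangedArc a′ S′ →
                           a ≡ a′ × (∀ i → S i ≡ S′ i)
  exchangedArc-injective {a} {a′} {S} {S′} eq = a≡a′ , sameSubset a≡a′
    where
    a≡a′ : a ≡ a′
    a≡a′ = canonicalArc-injective (begin
      canonicalArc a              ≡⟨ canon-exchangeAll (canonicalArc-isCanonical a) S ⟨
      canon (exchangedArc a S)    ≡⟨ cong canon eq ⟩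
      canon (exchangedArc a′ S′)  ≡⟨ canon-exchangeAll (canonicalArc-isCanonical a′) S′ ⟩
      canonicalArc a′             ∎)
      where open ≡-Reasoning
    sameSubset : a ≡ a′ → ∀ i → S i ≡ S′ i
    sameSubset refl = exchangeAll-injective primeDivisors-unique
      (isEdge⇒components-differ {canonicalArc a} (arc-isEdge (lookup canonicalArcs a))) S S′ eq

  exchangedArc-index : ∀ a S → ∃ λ r → arc r ≡ exchangedArc a S
  exchangedArc-index a S = arc-surjective (exchangedArc a S)
    (exchangeAll-isEdge S {canonicalArc a} (arc-isEdge (lookup canonicalArcs a)))

  canonicalArcs*subsets≤arcs : C * 2 ^ primeCount ≤ R
  canonicalArcs*subsets≤arcs = injective⇒≤ {f = index} index-injective
    where
    index : Fin (C * 2 ^ primeCount) → Fin R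
    index i = let a , S = remQuot (2 ^ primeCount) i in proj₁ (exchangedArc-index a (finToFun S))
    index-injective : ∀ {i j} → index i ≡ index j → i ≡ j
    index-injective {i} {j} eq =
      let a , S = remQuot {C} (2 ^ primeCount) i
          b , T = remQuot {C} (2 ^ primeCount) j
          a≡b , S≗T = exchangedArc-injective (trans (sym (proj₂ (exchangedArc-index a (finToFun S))))
                                              (trans (cong arc eq) (proj₂ (exchangedArc-index b (finToFun T)))))
      in begin
        i           ≡⟨ combine-remQuot {C} (2 ^ primeCount) i ⟨
        combine a S ≡⟨ cong₂ combine a≡b (finToFun-injective {2} {primeCount} S≗T) ⟩
        combine b T ≡⟨ combine-remQuot {C} (2 ^ primeCount) j ⟩
        j           ∎
      where open ≡-Reasoning

open import Data.Nat using (suc; _*_; _^_; _≤_; s≤s; z≤n; >-nonZero)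
open import Data.Nat.Properties using (≤-trans; ≤-antisym; *-cancelʳ-≤; m^n>0)
open import Data.Product using (∃; _×_; _,_)
open import Relation.Binary.PropositionalEquality using (_≡_)

theorem2 : (n : ℕ) → 2 ≤ n →
    ∃ λ c → IsStrongChromaticIndex (UnitaryAdj n) c × c * 2 ^ ω n ≡ n * φ n
theorem2 (suc (suc n-2)) (s≤s (s≤s z≤n)) = C , (strongEdgeColouring , minimal) , C*2^ω≡n*φn
  where
  open UnitaryCayley n-2
  open LowerBound n-2
  open UpperBound n-2
  C*2^ω≡n*φn : C * 2 ^ ω n ≡ n * φ n
  C*2^ω≡n*φn = ≤-antisym canonicalArcs*subsets≤arcs (colouring⇒n*φn≤m*2^ω strongEdgeColouring)
  minimal : ∀ m → StrongEdgeColouring Adjacent m → C ≤ m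
  minimal m colouring = *-cancelʳ-≤ C m (2 ^ ω n) {{>-nonZero (m^n>0 2 (ω n))}}
                          (≤-trans canonicalArcs*subsets≤arcs (colouring⇒n*φn≤m*2^ω colouring))
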